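{- Let $\mathbf{A}$ be a distributive nearlattice. If for every $a\in A$ the annihilator $a^{\top}$ is a principal filter (i.e. $a^{\top}=[b)=\{x\in A\colon b\le x\}$ for some $b\in A$), then $\mathbf{A}$ is quasicomplemented.
   Context: A distributive nearlattice is a join-semilattice $\langle A,\vee,1\rangle$ with greatest element $1$ in which every principal filter $[a)=\{x\in A\colon a\le x\}$ is a bounded distributive lattice. For $a\in A$, $a^{\top}=\{x\in A\colon x\vee a=1\}$ and $a^{\top\top}=\{y\in A\colon y\vee x=1\text{ for all }x\in a^{\top}\}$. $\mathbf{A}$ is quasicomplemented if for each $a\in A$ there exists $b\in A$ with $a^{\top\top}=b^{\top}$. -}

module Defs where

open import Level using (Level; suc; _⊔_)
open import Relation.Binary.PropositionalEquality using (_≡_)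
open import Data.Product using (Σ; _×_)
open import Data.Product using (∃-syntax)

record JoinSemilattice1 (ℓ : Level) : Set (suc ℓ) where
  field
    Carrier : Set ℓ
    _∨_     : Carrier → Carrier → Carrier
    𝟙       : Carrier
    ∨-assoc : ∀ x y z → (x ∨ y) ∨ z ≡ x ∨ (y ∨ z)
    ∨-comm  : ∀ x y → x ∨ y ≡ y ∨ x
    ∨-idem  : ∀ x → x ∨ x ≡ x
    ∨-𝟙     : ∀ x → x ∨ 𝟙 ≡ 𝟙

  infixr 6 _∨_
  infix 4 _≤_

  _≤_ : Carrier → Carrier → Set ℓ
  x ≤ y = x ∨ y ≡ y

  [_⟩ : Carrier → Carrier → Set ℓ
  [ a ⟩ x = a ≤ x

  IsMeetIn : Carrier → Carrier → Carrier → Carrier → Set ℓ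
  IsMeetIn a x y m =
    (a ≤ m) × (m ≤ x) × (m ≤ y) × (∀ z → a ≤ z → z ≤ x → z ≤ y → z ≤ m)

-- Distributive nearlattice: every principal filter [a) is a bounded
-- distributive lattice (bounded by a and 𝟙; joins are those of A, since
-- [a) is closed under ∨ and joins in [a) coincide with those in A).
record DistributiveNearlattice (ℓ : Level) : Set (suc ℓ) where
  field
    semilattice : JoinSemilattice1 ℓ
  open JoinSemilattice1 semilattice public
  field
    meet-exists : ∀ a x y → a ≤ x → a ≤ y → ∃[ m ] IsMeetIn a x y m
    distrib     : ∀ a x y z m₁ m₂ m₃ → a ≤ x → a ≤ y → a ≤ z →
                  IsMeetIn a x (y ∨ z) m₁ → IsMeetIn a x y m₂ → IsMeetIn a x z m₃ →
                  m₁ ≡ m₂ ∨ m₃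

module _ {ℓ : Level} (A : DistributiveNearlattice ℓ) where
  open DistributiveNearlattice A

  _^⊤ : Carrier → Carrier → Set ℓ
  (a ^⊤) x = x ∨ a ≡ 𝟙

  _^⊤⊤ : Carrier → Carrier → Set ℓ
  (a ^⊤⊤) y = ∀ x → (a ^⊤) x → y ∨ x ≡ 𝟙

  _≐_ : (Carrier → Set ℓ) → (Carrier → Set ℓ) → Set ℓ
  P ≐ Q = (∀ x → P x → Q x) × (∀ x → Q x → P x)

  IsQuasicomplemented : Set ℓ
  IsQuasicomplemented = ∀ a → Σ Carrier λ b → (a ^⊤⊤) ≐ (b ^⊤)

  AnnihilatorsPrincipal : Set ℓ
  AnnihilatorsPrincipal = ∀ a → Σ Carrier λ b → (a ^⊤) ≐ [ b ⟩

module Submission where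

open import Level using (Level)
open import Data.Product using (_,_)
open import Relation.Binary.PropositionalEquality using (_≡_; sym; cong; module ≡-Reasoning)
open import Defs

-- If a^⊤ = [b), then b itself lies in a^⊤, which gives a^⊤⊤ ⊆ b^⊤; conversely every
-- x ∈ a^⊤ lies above b, so y ∨ b = 1 forces y ∨ x = 1, giving b^⊤ ⊆ a^⊤⊤.

module _ {ℓ : Level} (A : DistributiveNearlattice ℓ) where
  open DistributiveNearlattice A
  open ≡-Reasoning

  ∨-𝟙ˡ : ∀ x → 𝟙 ∨ x ≡ 𝟙
  ∨-𝟙ˡ x = begin
    𝟙 ∨ x  ≡⟨ ∨-comm 𝟙 x ⟩
    x ∨ 𝟙  ≡⟨ ∨-𝟙 x ⟩
    𝟙      ∎

  ∨≡𝟙-monoʳ : ∀ {y b x} → b ≤ x → y ∨ b ≡ 𝟙 → y ∨ x ≡ 𝟙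
  ∨≡𝟙-monoʳ {y} {b} {x} b≤x y∨b≡𝟙 = begin
    y ∨ x        ≡⟨ cong (y ∨_) (sym b≤x) ⟩
    y ∨ (b ∨ x)  ≡⟨ sym (∨-assoc y b x) ⟩
    (y ∨ b) ∨ x  ≡⟨ cong (_∨ x) y∨b≡𝟙 ⟩
    𝟙 ∨ x        ≡⟨ ∨-𝟙ˡ x ⟩
    𝟙            ∎

  ^⊤≐[b⟩⇒^⊤⊤≐b^⊤ : ∀ a b → _≐_ A (_^⊤ A a) [ b ⟩ → _≐_ A (_^⊤⊤ A a) (_^⊤ A b)
  ^⊤≐[b⟩⇒^⊤⊤≐b^⊤ a b (a^⊤⊆[b⟩ , [b⟩⊆a^⊤) =
    (λ y y∈a^⊤⊤ → y∈a^⊤⊤ b ([b⟩⊆a^⊤ b (∨-idem b))) ,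
    (λ y y∨b≡𝟙 x x∈a^⊤ → ∨≡𝟙-monoʳ (a^⊤⊆[b⟩ x x∈a^⊤) y∨b≡𝟙)

lemma3p3 : {ℓ : Level} (A : DistributiveNearlattice ℓ) →
    AnnihilatorsPrincipal A → IsQuasicomplemented A
lemma3p3 A principal a =
  let b , a^⊤≐[b⟩ = principal a in b , ^⊤≐[b⟩⇒^⊤⊤≐b^⊤ A a b a^⊤≐[b⟩
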